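{- Let $k$ and $j_0$ be positive integers such that $\mathbf{B}_{j_0}^k$ is finite, and let $a_{j_0,k} = \max(\mathbf{B}_{j_0}^k)$. If $j_0 \ge \frac{a_{j_0,k}}{2^k-1}$, then $\overline{\mathbf{B}_j^k} = \emptyset$ for all $j \ge j_0$.
   Context: For positive integers $j,k$, a positive integer $n$ is called $(j,k)$-representable if $n = x_1^k + \cdots + x_j^k$ with all $x_i$ positive integers. Let $\mathbf{B}_j^k$ denote the set of positive integers that are not $(j,k)$-representable, and put $S_j^k = \{ n - j : n \in \mathbf{B}_j^k,\ n > j\}$. Define $\mathbf{B}^k = \bigcap_{j \ge 1} S_j^k$ and $\overline{\mathbf{B}_j^k} = S_j^k \setminus \mathbf{B}^k$. -}

module Defs where

open import Data.Nat using (ℕ; _+_; _*_; _∸_; _^_; _≤_; _<_)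
open import Data.Vec using (Vec; map; sum)
open import Data.Vec.Relation.Unary.All using (All)
open import Data.Product using (Σ; _×_; ∃)
open import Relation.Nullary using (¬_)
open import Relation.Binary.PropositionalEquality using (_≡_)

Representable : ℕ → ℕ → ℕ → Set
Representable j k n =
  Σ (Vec ℕ j) λ xs → All (λ x → 1 ≤ x) xs × sum (map (λ x → x ^ k) xs) ≡ n

InB : ℕ → ℕ → ℕ → Set
InB j k n = 1 ≤ n × ¬ Representable j k n

InS : ℕ → ℕ → ℕ → Set
InS j k m = ∃ λ n → InB j k n × j < n × m ≡ n ∸ j

InBk : ℕ → ℕ → Set
InBk k m = ∀ j → 1 ≤ j → InS j k m

InBbar : ℕ → ℕ → ℕ → Set
InBbar j k m = InS j k m × ¬ InBk k m

-- a is the maximum of 𝐁_j^k (in particular 𝐁_j^k is finite and nonempty)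
IsMaxB : ℕ → ℕ → ℕ → Set
IsMaxB j k a = InB j k a × (∀ n → InB j k n → n ≤ a)

-- Writing n = Σ xᵢ^k with j terms as n − j = Σ (xᵢ^k − 1), the set of excesses
-- n − j reachable with j terms grows with j (pad with ones).  The hypothesis makes
-- it stop growing at j₀: a sum of j₀ + 1 excesses either has a term 1^k − 1 = 0,
-- which can be dropped, or all its terms are at least 2^k − 1, so the sum exceeds
-- a − j₀ and is reachable with j₀ terms because max 𝐁_{j₀}^k = a.  Hence every
-- m ∈ S_j^k (j ≥ j₀) is unreachable with any number of terms, i.e. m ∈ 𝐁^k.
module Submission where

open import Defs
open import Data.Nat using (ℕ; zero; suc; _+_; _*_; _∸_; _^_; _≤_; _<_; z≤n; s≤s)
open import Data.Nat.Properties
open import Data.Vec using (Vec; []; _∷_; map; sum)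
open import Data.Vec.Relation.Unary.All using (All; []; _∷_)
open import Data.Vec.Relation.Unary.Any using (Any; here; there)
open import Data.Product using (Σ; _×_; _,_; proj₁; proj₂)
open import Data.Sum using (_⊎_; inj₁; inj₂)
open import Relation.Nullary using (¬_)
open import Relation.Binary.PropositionalEquality

module _ (k : ℕ) where

  excess : ℕ → ℕ
  excess x = x ^ k ∸ 1

  excessSum : ∀ {j} → Vec ℕ j → ℕ
  excessSum xs = sum (map excess xs)

  Positive : ∀ {j} → Vec ℕ j → Set
  Positive = All (1 ≤_)

  ShiftedRepresentable : ℕ → ℕ → Set
  ShiftedRepresentable j e = Σ (Vec ℕ j) λ xs → Positive xs × excessSum xs ≡ e

  excess-one : excess 1 ≡ 0
  excess-one = cong (_∸ 1) (^-zeroˡ k)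

  sum-^≡excessSum+length : ∀ {j} (xs : Vec ℕ j) → Positive xs →
                           sum (map (λ x → x ^ k) xs) ≡ excessSum xs + j
  sum-^≡excessSum+length [] [] = refl
  sum-^≡excessSum+length {suc j} (x@(suc _) ∷ xs) (_ ∷ ps) = begin
    x ^ k + sum (map (λ x → x ^ k) xs)
      ≡⟨ cong₂ _+_ (sym (m∸n+n≡m (m^n>0 x k))) (sum-^≡excessSum+length xs ps) ⟩
    (excess x + 1) + (excessSum xs + j)
      ≡⟨ +-assoc (excess x) 1 _ ⟩
    excess x + suc (excessSum xs + j)
      ≡⟨ cong (excess x +_) (sym (+-suc (excessSum xs) j)) ⟩
    excess x + (excessSum xs + suc j)
      ≡⟨ sym (+-assoc (excess x) (excessSum xs) (suc j)) ⟩
    excessSum (x ∷ xs) + suc j ∎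
    where open ≡-Reasoning

  representable⇒shifted : ∀ {j e} → Representable j k (e + j) → ShiftedRepresentable j e
  representable⇒shifted {j} {e} (xs , ps , eq) =
    xs , ps , +-cancelʳ-≡ j (excessSum xs) e (trans (sym (sum-^≡excessSum+length xs ps)) eq)

  shifted⇒representable : ∀ {j e} → ShiftedRepresentable j e → Representable j k (e + j)
  shifted⇒representable {j} (xs , ps , eq) =
    xs , ps , trans (sum-^≡excessSum+length xs ps) (cong (_+ j) eq)

  inS⇒¬shifted : ∀ {j m} → InS j k m → 1 ≤ m × ¬ ShiftedRepresentable j m
  inS⇒¬shifted {j} {m} (n , (_ , ¬rep) , j<n , m≡n∸j) =
    subst (1 ≤_) (sym m≡n∸j) (m<n⇒0<n∸m j<n) ,
    λ s → ¬rep (subst (Representable j k) m+j≡n (shifted⇒representable s))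
    where
    m+j≡n : m + j ≡ n
    m+j≡n = trans (cong (_+ j) m≡n∸j) (m∸n+n≡m (<⇒≤ j<n))

  ¬shifted⇒inS : ∀ {j m} → 1 ≤ m → ¬ ShiftedRepresentable j m → InS j k m
  ¬shifted⇒inS {j} {m} 1≤m ¬s =
    m + j , (≤-trans 1≤m (m≤m+n m j) , λ r → ¬s (representable⇒shifted r)) ,
    +-monoˡ-≤ j 1≤m , sym (m+n∸n≡m m j)

  shifted-zero : ∀ j → ShiftedRepresentable j 0
  shifted-zero zero = [] , [] , refl
  shifted-zero (suc j) with shifted-zero j
  ... | ys , ps , eq = 1 ∷ ys , s≤s z≤n ∷ ps , cong₂ _+_ excess-one eq

  shifted-mono : ∀ {j j′ e} → j ≤ j′ → ShiftedRepresentable j e → ShiftedRepresentable j′ e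
  shifted-mono {j′ = j′} z≤n ([] , [] , refl) = shifted-zero j′
  shifted-mono (s≤s j≤j′) (x ∷ xs , p ∷ ps , refl) with shifted-mono j≤j′ (xs , ps , refl)
  ... | ys , qs , eq = x ∷ ys , p ∷ qs , cong (excess x +_) eq

  shifted-dropOne : ∀ {j} (xs : Vec ℕ (suc j)) → Positive xs → Any (_≡ 1) xs →
                    ShiftedRepresentable j (excessSum xs)
  shifted-dropOne (_ ∷ xs) (_ ∷ ps) (here refl) = xs , ps , cong (_+ excessSum xs) (sym excess-one)
  shifted-dropOne {suc j} (x ∷ xs) (p ∷ ps) (there one∈xs)
    with shifted-dropOne xs ps one∈xs
  ... | ys , qs , eq = x ∷ ys , p ∷ qs , cong (excess x +_) eq

  hasOne⊎all≥2 : ∀ {j} (xs : Vec ℕ j) → Positive xs → Any (_≡ 1) xs ⊎ All (2 ≤_) xs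
  hasOne⊎all≥2 [] [] = inj₂ []
  hasOne⊎all≥2 (zero ∷ _) (() ∷ _)
  hasOne⊎all≥2 (suc zero ∷ _) _ = inj₁ (here refl)
  hasOne⊎all≥2 (suc (suc _) ∷ xs) (_ ∷ ps) with hasOne⊎all≥2 xs ps
  ... | inj₁ one∈xs = inj₁ (there one∈xs)
  ... | inj₂ all≥2  = inj₂ (s≤s (s≤s z≤n) ∷ all≥2)

  length*excess2≤excessSum : ∀ {j} (xs : Vec ℕ j) → All (2 ≤_) xs → j * excess 2 ≤ excessSum xs
  length*excess2≤excessSum [] [] = z≤n
  length*excess2≤excessSum (x ∷ xs) (2≤x ∷ all≥2) =
    +-mono-≤ (∸-monoˡ-≤ 1 (^-monoˡ-≤ k 2≤x)) (length*excess2≤excessSum xs all≥2)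

  1≤excess2 : 1 ≤ k → 1 ≤ excess 2
  1≤excess2 1≤k = ∸-monoˡ-≤ 1 (^-monoʳ-≤ 2 1≤k)

  module _ {j a : ℕ} (bound : ∀ n → InB j k n → n ≤ a) where

    shifted-beyondBound : ∀ {e} → a < e + j → ¬ ¬ ShiftedRepresentable j e
    shifted-beyondBound {e} a<e+j ¬s =
      <⇒≱ a<e+j (bound (e + j) (≤-trans (s≤s z≤n) a<e+j , λ r → ¬s (representable⇒shifted r)))

    module _ (1≤k : 1 ≤ k) (a≤j*excess2 : a ≤ j * excess 2) where

      shifted-pred : ∀ {e} → ShiftedRepresentable (suc j) e → ¬ ¬ ShiftedRepresentable j e
      shifted-pred (xs , ps , refl) with hasOne⊎all≥2 xs ps
      ... | inj₁ one∈xs = λ ¬s → ¬s (shifted-dropOne xs ps one∈xs)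
      ... | inj₂ all≥2  = shifted-beyondBound (begin-strict
        a                                   ≤⟨ a≤j*excess2 ⟩
        j * excess 2                        <⟨ m<n+m _ (1≤excess2 1≤k) ⟩
        suc j * excess 2                    ≤⟨ length*excess2≤excessSum xs all≥2 ⟩
        excessSum xs                        ≤⟨ m≤m+n _ j ⟩
        excessSum xs + j                    ∎)
        where open ≤-Reasoning

      shifted-saturate : ∀ {t e} → ShiftedRepresentable t e → ¬ ¬ ShiftedRepresentable j e
      shifted-saturate {zero} ([] , [] , refl) ¬s = ¬s (shifted-zero j)
      shifted-saturate {suc t} (x ∷ xs , p ∷ ps , refl) ¬s =
        shifted-saturate (xs , ps , refl) λ (ys , qs , eq) →
          shifted-pred (x ∷ ys , p ∷ qs , cong (excess x +_) eq) ¬s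

corollary10p13 : (k j₀ a : ℕ) → 1 ≤ k → 1 ≤ j₀ → IsMaxB j₀ k a →
    a ≤ j₀ * (2 ^ k ∸ 1) →
    ∀ j → j₀ ≤ j → ∀ m → ¬ InBbar j k m
corollary10p13 k j₀ a 1≤k _ (_ , bound) a≤j₀*excess2 j j₀≤j m (m∈S , m∉Bk) =
  m∉Bk λ _ _ → ¬shifted⇒inS k 1≤m λ s →
    shifted-saturate k bound 1≤k a≤j₀*excess2 s λ s₀ → ¬s (shifted-mono k j₀≤j s₀)
  where
  1≤m : 1 ≤ m
  1≤m = proj₁ (inS⇒¬shifted k m∈S)
  ¬s : ¬ ShiftedRepresentable k j m
  ¬s = proj₂ (inS⇒¬shifted k m∈S)
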